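{- Let $G$ be the niche graph of a bipartite tournament $D$. Then for two vertices $u,v$ in the same partite set of $D$, $uv\notin E(G)$ if and only if $u\,\mathcal{R}_D\, v$.
   Context: A bipartite tournament is an orientation of a complete bipartite graph. The niche graph of a digraph $D$ is the simple graph with vertex set $V(D)$ in which distinct $u,v$ are adjacent iff there is a vertex $w$ with $(u,w),(v,w)\in A(D)$, or with $(w,u),(w,v)\in A(D)$. Write $u\,\mathcal{R}_D\, v$ iff $u$ and $v$ belong to the same partite set of $D$ and $N^+_D(u)=N^-_D(v)$, where $N^+_D,N^-_D$ denote out- and in-neighborhoods. -}

module Defs where

open import Data.Nat using (ℕ)
open import Data.Fin using (Fin)
open import Data.Bool using (Bool)
open import Data.Product using (_×_; ∃-syntax)
open import Data.Sum using (_⊎_)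
open import Relation.Nullary using (¬_)
open import Relation.Binary.PropositionalEquality using (_≡_; _≢_)
open import Function.Bundles using (_⇔_)

-- A bipartite tournament on vertex set Fin n: an orientation of the complete
-- bipartite graph whose bipartition is given by `side` (the two partite sets
-- are the vertices with side true / side false).
record BipartiteTournament (n : ℕ) : Set₁ where
  field
    side : Fin n → Bool
    Arc  : Fin n → Fin n → Set
    noArcWithin : ∀ u v → side u ≡ side v → ¬ Arc u v
    arcBetween  : ∀ u v → side u ≢ side v → Arc u v ⊎ Arc v u
    oriented    : ∀ u v → ¬ (Arc u v × Arc v u)

open BipartiteTournament public

SamePart : ∀ {n} → BipartiteTournament n → Fin n → Fin n → Set
SamePart D u v = side D u ≡ side D v

_∈N⁺[_]_ : ∀ {n} → Fin n → BipartiteTournament n → Fin n → Set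
w ∈N⁺[ D ] u = Arc D u w

_∈N⁻[_]_ : ∀ {n} → Fin n → BipartiteTournament n → Fin n → Set
w ∈N⁻[ D ] u = Arc D w u

NicheEdge : ∀ {n} → BipartiteTournament n → Fin n → Fin n → Set
NicheEdge D u v =
  u ≢ v × ∃[ w ] ((Arc D u w × Arc D v w) ⊎ (Arc D w u × Arc D w v))

R : ∀ {n} → BipartiteTournament n → Fin n → Fin n → Set
R D u v = SamePart D u v × (∀ w → (w ∈N⁺[ D ] u) ⇔ (w ∈N⁻[ D ] v))

-- If u and v lie in the same partite set, every vertex w of the other set is
-- joined to both of them. So u → w forces either w → v or v → w (a common
-- out-neighbour), and w → v forces either u → w or w → u (a common
-- in-neighbour). Hence u, v have no common neighbour exactly when every arc
-- u → w continues to v and every arc w → v comes from u, i.e. N⁺(u) = N⁻(v);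
-- conversely N⁺(u) = N⁻(v) turns a common neighbour into a 2-cycle.
module Submission where

open import Defs
open import Data.Fin using (Fin)
open import Data.Product using (_,_)
open import Data.Sum using (_⊎_; inj₁; inj₂)
open import Relation.Nullary using (¬_)
open import Relation.Binary.PropositionalEquality using (_≢_; sym; trans)
open import Function.Bundles using (_⇔_; mk⇔; Equivalence)

module _ {n} (D : BipartiteTournament n) where

  arc⇒differentParts : ∀ {u w} → Arc D u w → ¬ SamePart D u w
  arc⇒differentParts {u} {w} u→w same = noArcWithin D u w same u→w

  arcOut⇒joinedToPart : ∀ {u v w} → SamePart D u v → Arc D u w →
                        Arc D w v ⊎ Arc D v w
  arcOut⇒joinedToPart {v = v} {w} u~v u→w =
    arcBetween D w v λ w~v → arc⇒differentParts u→w (trans u~v (sym w~v))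

  arcIn⇒joinedToPart : ∀ {u v w} → SamePart D u v → Arc D w v →
                       Arc D u w ⊎ Arc D w u
  arcIn⇒joinedToPart {u} {w = w} u~v w→v =
    arcBetween D u w λ u~w → arc⇒differentParts w→v (trans (sym u~w) u~v)

  ¬NicheEdge⇒R : ∀ {u v} → u ≢ v → SamePart D u v → ¬ NicheEdge D u v → R D u v
  ¬NicheEdge⇒R {u} {v} u≢v u~v noEdge = u~v , λ w → mk⇔ (out⇒in w) (in⇒out w)
    where
    out⇒in : ∀ w → Arc D u w → Arc D w v
    out⇒in w u→w with arcOut⇒joinedToPart u~v u→w
    ... | inj₁ w→v = w→v
    ... | inj₂ v→w with () ← noEdge (u≢v , w , inj₁ (u→w , v→w))

    in⇒out : ∀ w → Arc D w v → Arc D u w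
    in⇒out w w→v with arcIn⇒joinedToPart u~v w→v
    ... | inj₁ u→w = u→w
    ... | inj₂ w→u with () ← noEdge (u≢v , w , inj₂ (w→u , w→v))

  R⇒¬NicheEdge : ∀ {u v} → R D u v → ¬ NicheEdge D u v
  R⇒¬NicheEdge {u} {v} (_ , N⁺u≡N⁻v) (_ , w , inj₁ (u→w , v→w)) =
    oriented D w v (Equivalence.to (N⁺u≡N⁻v w) u→w , v→w)
  R⇒¬NicheEdge {u} {v} (_ , N⁺u≡N⁻v) (_ , w , inj₂ (w→u , w→v)) =
    oriented D u w (Equivalence.from (N⁺u≡N⁻v w) w→v , w→u)

proposition2p6 : ∀ {n} (D : BipartiteTournament n) (u v : Fin n) →
    u ≢ v → SamePart D u v → (¬ NicheEdge D u v) ⇔ R D u v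
proposition2p6 D u v u≢v u~v = mk⇔ (¬NicheEdge⇒R D u≢v u~v) (R⇒¬NicheEdge D)
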